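{- Let $n>20$ be an integer. Then $A(n,2)=B(n,2)$.
   Context: $\mathrm{DGP}(n,k)$ is the canonical double cover of the generalized Petersen graph $\mathrm{GP}(n,k)$: vertex set $\{(u_i,j),(v_i,j): 0\le i\le n-1, j\in\{0,1\}\}$, edges $\{(u_i,j),(u_{i+1},1-j)\}$, $\{(v_i,j),(v_{i+k},1-j)\}$, and spokes $\{(u_i,j),(v_i,1-j)\}$ (subscripts mod $n$). $A(n,k)=\mathrm{Aut}(\mathrm{DGP}(n,k))$ and $B(n,k)$ is the setwise stabilizer in $A(n,k)$ of the set of spokes. -}

module Defs where

open import Data.Nat using (ℕ; zero; suc; _+_)
open import Data.Nat.DivMod using (_%_; m%n<n)
open import Data.Fin using (Fin; toℕ; fromℕ<)
open import Data.Bool using (Bool; not)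
open import Data.Product using (_×_; _,_; ∃)
open import Data.Sum using (_⊎_)
open import Function.Bundles using (_↔_; Inverse)
open import Relation.Binary.PropositionalEquality using (_≡_)

next : ∀ {n} → Fin n → Fin n
next {suc m} i = fromℕ< (m%n<n (toℕ i + 1) (suc m))

shift : ∀ {n} → ℕ → Fin n → Fin n
shift zero    i = i
shift (suc k) i = next (shift k i)

data Layer : Set where
  uL vL : Layer

-- vertex (u_i , j) is (uL , i , j);  vertex (v_i , j) is (vL , i , j)
Vertex : ℕ → Set
Vertex n = Layer × Fin n × Bool

data Rim (n k : ℕ) : Vertex n → Vertex n → Set where
  outer : ∀ i j → Rim n k (uL , i , j) (uL , shift 1 i , not j)
  inner : ∀ i j → Rim n k (vL , i , j) (vL , shift k i , not j)

data SpokeE (n : ℕ) : Vertex n → Vertex n → Set where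
  spoke : ∀ i j → SpokeE n (uL , i , j) (vL , i , not j)

Edge : (n k : ℕ) → Vertex n → Vertex n → Set
Edge n k x y = Rim n k x y ⊎ SpokeE n x y

Adj : (n k : ℕ) → Vertex n → Vertex n → Set
Adj n k x y = Edge n k x y ⊎ Edge n k y x

Spoke : (n : ℕ) → Vertex n → Vertex n → Set
Spoke n x y = SpokeE n x y ⊎ SpokeE n y x

IsAut : (n k : ℕ) → (Vertex n ↔ Vertex n) → Set
IsAut n k f = ∀ x y → (Adj n k x y → Adj n k (to x) (to y))
                    × (Adj n k (to x) (to y) → Adj n k x y)
  where open Inverse f

-- B(n,k): f maps the set of spokes onto itself (setwise stabilizer: f(S) = S)
StabilizesSpokes : (n : ℕ) → (Vertex n ↔ Vertex n) → Set
StabilizesSpokes n f =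
    (∀ x y → Spoke n x y → Spoke n (to x) (to y))
  × (∀ x y → Spoke n x y → ∃ λ x' → ∃ λ y' → Spoke n x' y' × to x' ≡ x × to y' ≡ y)
  where open Inverse f

-- That every 3-arc a x y b starting with an edge at x lies on an 8-cycle is a property of x
-- invariant under automorphisms.  Every outer vertex u_i has it, whereas no 8-cycle passes through
-- v_{i-2} v_i v_{i+2} v_{i+4}, so no inner vertex does.  Hence automorphisms preserve the two
-- layers, and the spokes are exactly the edges joining them.  Both facts involve only vertices
-- whose indices lie in a window of 21 consecutive residues; for n > 20 such a window embeds
-- injectively into Z_n, so they are decided by a finite computation on the infinite cover.

module Submission where

open import Defs
open import Data.Nat using (ℕ; zero; suc; _+_; _∸_; _<_; _≤_; z≤n; s≤s; NonZero)
import Data.Nat as ℕ using (_≟_; _≤?_)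
open import Data.Nat.Properties
  using (+-assoc; +-comm; +-identityʳ; m∸n+n≡m; m+[n∸m]≡n; <⇒≤; ≤-refl; ≤-trans; <-≤-trans;
         m≤m+n; m≤n+m; +-monoʳ-≤)
open import Data.Nat.DivMod using (_%_; %-distribˡ-+; m%n%n≡m%n; [m+n]%n≡m%n; %-remove-+ˡ; m<n⇒m%n≡m)
open import Data.Nat.Divisibility using (∣-refl)
open import Data.Bool using (Bool; true; false; not; _xor_)
import Data.Bool.Properties as Bool
open import Data.Fin using (Fin; toℕ)
open import Data.Fin.Properties using (toℕ-injective; toℕ-fromℕ<; toℕ<n)
open import Data.Empty using (⊥-elim)
open import Data.Product using (_×_; _,_; proj₁; proj₂; ∃; uncurry)
open import Data.Product.Properties using (≡-dec)
open import Data.Sum using (inj₁; inj₂; swap)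
open import Data.List using (List; []; _∷_; map)
open import Data.List.Relation.Unary.All as All using (All; []; _∷_; all?)
import Data.List.Relation.Unary.All.Properties as All
open import Data.List.Relation.Unary.Any using (Any; here; there; any?)
open import Data.List.Relation.Unary.AllPairs using ([]; _∷_)
open import Data.List.Relation.Unary.Unique.Propositional using (Unique)
import Data.List.Relation.Unary.Unique.Propositional.Properties as Unique
open import Data.List.Membership.Propositional using (_∈_; find; lose)
open import Function.Base using (_∘_)
open import Function.Bundles using (_↔_; Inverse; Injection)
open import Function.Properties.Inverse using (↔-sym; ↔⇒↣)
open import Relation.Binary.Definitions using (DecidableEquality)
open import Relation.Binary.PropositionalEquality
open import Relation.Nullary using (¬_; Dec; yes; no; ¬?; _×-dec_; _→-dec_)
open import Relation.Nullary.Decidable using (from-yes; from-no; map′)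
open import Relation.Unary using (Decidable)

[m%d+n]%d≡[m+n]%d : ∀ m n d .{{_ : NonZero d}} → (m % d + n) % d ≡ (m + n) % d
[m%d+n]%d≡[m+n]%d m n d = begin
  (m % d + n) % d          ≡⟨ %-distribˡ-+ (m % d) n d ⟩
  (m % d % d + n % d) % d  ≡⟨ cong (λ k → (k + n % d) % d) (m%n%n≡m%n m d) ⟩
  (m % d + n % d) % d      ≡⟨ %-distribˡ-+ m n d ⟨
  (m + n) % d              ∎
  where open ≡-Reasoning

%-cancelˡ-+ : ∀ t {a b} d .{{_ : NonZero d}} → t ≤ d → (t + a) % d ≡ (t + b) % d → a % d ≡ b % d
%-cancelˡ-+ t {a} {b} d t≤d eq = begin
  a % d                      ≡⟨ undo a ⟨
  ((t + a) % d + (d ∸ t)) % d ≡⟨ cong (λ k → (k + (d ∸ t)) % d) eq ⟩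
  ((t + b) % d + (d ∸ t)) % d ≡⟨ undo b ⟩
  b % d                      ∎
  where
  open ≡-Reasoning
  undo : ∀ c → ((t + c) % d + (d ∸ t)) % d ≡ c % d
  undo c = begin
    ((t + c) % d + (d ∸ t)) % d ≡⟨ [m%d+n]%d≡[m+n]%d (t + c) (d ∸ t) d ⟩
    (t + c + (d ∸ t)) % d       ≡⟨ cong (_% d) (+-comm (t + c) (d ∸ t)) ⟩
    ((d ∸ t) + (t + c)) % d     ≡⟨ cong (_% d) (+-assoc (d ∸ t) t c) ⟨
    ((d ∸ t) + t + c) % d       ≡⟨ cong (λ k → (k + c) % d) (m∸n+n≡m t≤d) ⟩
    (d + c) % d                 ≡⟨ %-remove-+ˡ c (∣-refl {d}) ⟩
    c % d                       ∎

module Cyclic (m : ℕ) where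

  N : ℕ
  N = suc m

  toℕ-shift : ∀ c (i : Fin N) → toℕ (shift c i) ≡ (toℕ i + c) % N
  toℕ-shift zero    i = begin
    toℕ i            ≡⟨ m<n⇒m%n≡m (toℕ<n i) ⟨
    toℕ i % N        ≡⟨ cong (_% N) (+-identityʳ (toℕ i)) ⟨
    (toℕ i + 0) % N  ∎
    where open ≡-Reasoning
  toℕ-shift (suc c) i = begin
    toℕ (next (shift c i))         ≡⟨ toℕ-fromℕ< _ ⟩
    (toℕ (shift c i) + 1) % N      ≡⟨ cong (λ k → (k + 1) % N) (toℕ-shift c i) ⟩
    ((toℕ i + c) % N + 1) % N      ≡⟨ [m%d+n]%d≡[m+n]%d (toℕ i + c) 1 N ⟩
    (toℕ i + c + 1) % N            ≡⟨ cong (_% N) (+-assoc (toℕ i) c 1) ⟩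
    (toℕ i + (c + 1)) % N          ≡⟨ cong (λ k → (toℕ i + k) % N) (+-comm c 1) ⟩
    (toℕ i + suc c) % N            ∎
    where open ≡-Reasoning

  shift-+ : ∀ a c (i : Fin N) → shift (a + c) i ≡ shift a (shift c i)
  shift-+ zero    c i = refl
  shift-+ (suc a) c i = cong next (shift-+ a c i)

  shift-N : ∀ (i : Fin N) → shift N i ≡ i
  shift-N i = toℕ-injective (begin
    toℕ (shift N i)  ≡⟨ toℕ-shift N i ⟩
    (toℕ i + N) % N  ≡⟨ [m+n]%n≡m%n (toℕ i) N ⟩
    toℕ i % N        ≡⟨ m<n⇒m%n≡m (toℕ<n i) ⟩
    toℕ i            ∎)
    where open ≡-Reasoning

  shift-∸ : ∀ {c} → c ≤ N → (i : Fin N) → shift c (shift (N ∸ c) i) ≡ i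
  shift-∸ {c} c≤N i = begin
    shift c (shift (N ∸ c) i)  ≡⟨ shift-+ c (N ∸ c) i ⟨
    shift (c + (N ∸ c)) i      ≡⟨ cong (λ k → shift k i) (m+[n∸m]≡n c≤N) ⟩
    shift N i                  ≡⟨ shift-N i ⟩
    i                          ∎
    where open ≡-Reasoning

  shift-injectiveˡ : ∀ {c c'} (i : Fin N) → c < N → c' < N → shift c i ≡ shift c' i → c ≡ c'
  shift-injectiveˡ {c} {c'} i c<N c'<N eq = begin
    c       ≡⟨ m<n⇒m%n≡m c<N ⟨
    c % N   ≡⟨ %-cancelˡ-+ (toℕ i) N (<⇒≤ (toℕ<n i)) (begin
                 (toℕ i + c) % N   ≡⟨ toℕ-shift c i ⟨
                 toℕ (shift c i)   ≡⟨ cong toℕ eq ⟩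
                 toℕ (shift c' i)  ≡⟨ toℕ-shift c' i ⟩
                 (toℕ i + c') % N  ∎) ⟩
    c' % N  ≡⟨ m<n⇒m%n≡m c'<N ⟩
    c'      ∎
    where open ≡-Reasoning

  shift-injectiveʳ : ∀ c {i i' : Fin N} → c ≤ N → shift c i ≡ shift c i' → i ≡ i'
  shift-injectiveʳ c {i} {i'} c≤N eq = toℕ-injective (begin
    toℕ i       ≡⟨ m<n⇒m%n≡m (toℕ<n i) ⟨
    toℕ i % N   ≡⟨ %-cancelˡ-+ c N c≤N (begin
                     (c + toℕ i) % N   ≡⟨ cong (_% N) (+-comm c (toℕ i)) ⟩
                     (toℕ i + c) % N   ≡⟨ toℕ-shift c i ⟨
                     toℕ (shift c i)   ≡⟨ cong toℕ eq ⟩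
                     toℕ (shift c i')  ≡⟨ toℕ-shift c i' ⟩
                     (toℕ i' + c) % N  ≡⟨ cong (_% N) (+-comm (toℕ i') c) ⟩
                     (c + toℕ i') % N  ∎) ⟩
    toℕ i' % N  ≡⟨ m<n⇒m%n≡m (toℕ<n i') ⟩
    toℕ i'      ∎)
    where open ≡-Reasoning

xor-cancelʳ : ∀ {p q} j → p xor j ≡ q xor j → p ≡ q
xor-cancelʳ {p} {q} j e = begin
  p                ≡⟨ undo p ⟨
  (p xor j) xor j  ≡⟨ cong (_xor j) e ⟩
  (q xor j) xor j  ≡⟨ undo q ⟩
  q                ∎
  where
  open ≡-Reasoning
  undo : ∀ r → (r xor j) xor j ≡ r
  undo r = begin
    (r xor j) xor j  ≡⟨ Bool.xor-assoc r j j ⟩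
    r xor (j xor j)  ≡⟨ cong (r xor_) (Bool.xor-same j) ⟩
    r xor false      ≡⟨ Bool.xor-identityʳ r ⟩
    r                ∎

module EightCycles {V : Set} (Adj : V → V → Set) where

  On8Cycle : V → V → V → V → Set
  On8Cycle a x y b = ∃ λ x₄ → ∃ λ x₅ → ∃ λ x₆ → ∃ λ x₇ →
    Adj b x₄ × Adj x₄ x₅ × Adj x₅ x₆ × Adj x₆ x₇ × Adj x₇ a ×
    Unique (a ∷ x ∷ y ∷ b ∷ x₄ ∷ x₅ ∷ x₆ ∷ x₇ ∷ [])

  ArcsOn8Cycles : V → Set
  ArcsOn8Cycles x = ∀ {y a b} → Adj x y → Adj x a → a ≢ y → Adj y b → b ≢ x → On8Cycle a x y b

  IsAutomorphism : V ↔ V → Set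
  IsAutomorphism f = ∀ x y → (Adj x y → Adj (to x) (to y)) × (Adj (to x) (to y) → Adj x y)
    where open Inverse f

  IsAutomorphism-sym : ∀ {f} → IsAutomorphism f → IsAutomorphism (↔-sym f)
  IsAutomorphism-sym {f} aut x y =
      (λ e → proj₂ (aut (from x) (from y)) (subst₂ Adj (sym (strictlyInverseˡ x)) (sym (strictlyInverseˡ y)) e))
    , (λ e → subst₂ Adj (strictlyInverseˡ x) (strictlyInverseˡ y) (proj₁ (aut (from x) (from y)) e))
    where open Inverse f

  module _ {f : V ↔ V} (aut : IsAutomorphism f) where
    open Inverse f

    On8Cycle-image : ∀ {a x y b} → On8Cycle a x y b → On8Cycle (to a) (to x) (to y) (to b)
    On8Cycle-image (x₄ , x₅ , x₆ , x₇ , e₄ , e₅ , e₆ , e₇ , e₈ , distinct) =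
      to x₄ , to x₅ , to x₆ , to x₇ ,
      image e₄ , image e₅ , image e₆ , image e₇ , image e₈ ,
      Unique.map⁺ (Injection.injective (↔⇒↣ f)) distinct
      where
      image : ∀ {u v} → Adj u v → Adj (to u) (to v)
      image {u} {v} = proj₁ (aut u v)

    ArcsOn8Cycles-image : ∀ {x} → ArcsOn8Cycles x → ArcsOn8Cycles (to x)
    ArcsOn8Cycles-image {x} arcs {y} {a} {b} xy xa a≢y yb b≢x =
      respects (strictlyInverseˡ a) (strictlyInverseˡ y) (strictlyInverseˡ b)
        (On8Cycle-image (arcs (pull xy) (pull xa) (a≢y ∘ Injection.injective (↔⇒↣ (↔-sym f))) (preimage yb) (b≢x ∘ moved)))
      where
      preimage : ∀ {u v} → Adj u v → Adj (from u) (from v)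
      preimage {u} {v} = proj₁ (IsAutomorphism-sym {f} aut u v)
      pull : ∀ {v} → Adj (to x) v → Adj x (from v)
      pull {v} e = subst (λ u → Adj u (from v)) (strictlyInverseʳ x) (preimage e)
      moved : from b ≡ x → b ≡ to x
      moved e = trans (sym (strictlyInverseˡ b)) (cong to e)
      respects : ∀ {a a' y y' b b'} → a ≡ a' → y ≡ y' → b ≡ b' →
                 On8Cycle a (to x) y b → On8Cycle a' (to x) y' b'
      respects refl refl refl c = c

  ArcsOn8Cycles-preimage : ∀ {f} → IsAutomorphism f → ∀ {x} → ArcsOn8Cycles (Inverse.to f x) → ArcsOn8Cycles x
  ArcsOn8Cycles-preimage {f} aut {x} =
    subst ArcsOn8Cycles (Inverse.strictlyInverseʳ f x) ∘ ArcsOn8Cycles-image {↔-sym f} (IsAutomorphism-sym {f} aut)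

spoke⇒adj : ∀ {n k x y} → Spoke n x y → Adj n k x y
spoke⇒adj (inj₁ s) = inj₁ (inj₂ s)
spoke⇒adj (inj₂ s) = inj₂ (inj₂ s)

spoke-crosses : ∀ {n x y} → Spoke n x y → proj₁ x ≢ proj₁ y
spoke-crosses (inj₁ (spoke _ _)) ()
spoke-crosses (inj₂ (spoke _ _)) ()

crossing-edge⇒spoke : ∀ {n k x y} → Adj n k x y → proj₁ x ≢ proj₁ y → Spoke n x y
crossing-edge⇒spoke (inj₁ (inj₁ (outer _ _))) crosses = ⊥-elim (crosses refl)
crossing-edge⇒spoke (inj₁ (inj₁ (inner _ _))) crosses = ⊥-elim (crosses refl)
crossing-edge⇒spoke (inj₁ (inj₂ s))           _       = inj₁ s
crossing-edge⇒spoke (inj₂ (inj₁ (outer _ _))) crosses = ⊥-elim (crosses refl)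
crossing-edge⇒spoke (inj₂ (inj₁ (inner _ _))) crosses = ⊥-elim (crosses refl)
crossing-edge⇒spoke (inj₂ (inj₂ s))           _       = inj₂ s

-- (l , c , p) stands for the vertex (l_{b+c} , p xor j) of the chart around (b , j) below.
-- Vertices with c < 2 get no neighbours, so that nbrs is sound everywhere and complete on Window.
Loc : Set
Loc = Layer × ℕ × Bool

index : Loc → ℕ
index (_ , c , _) = c

nbrs : Loc → List Loc
nbrs (uL , suc (suc c) , p) = (uL , 3 + c , not p) ∷ (uL , 1 + c , not p) ∷ (vL , 2 + c , not p) ∷ []
nbrs (vL , suc (suc c) , p) = (vL , 4 + c , not p) ∷ (vL , c , not p) ∷ (uL , 2 + c , not p) ∷ []
nbrs _ = []

nbrs-index : ∀ {p q} → q ∈ nbrs p → index q ≤ 2 + index p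
nbrs-index {uL , suc (suc c) , _} (here refl)                 = m≤n+m (3 + c) 1
nbrs-index {uL , suc (suc c) , _} (there (here refl))         = m≤n+m (1 + c) 3
nbrs-index {uL , suc (suc c) , _} (there (there (here refl))) = m≤n+m (2 + c) 2
nbrs-index {vL , suc (suc c) , _} (here refl)                 = ≤-refl
nbrs-index {vL , suc (suc c) , _} (there (here refl))         = m≤n+m c 4
nbrs-index {vL , suc (suc c) , _} (there (there (here refl))) = m≤n+m (2 + c) 2

Small : Loc → Set
Small p = index p < 21

-- Neighbours of window vertices are Small, and the chart is injective on Small vertices as 21 ≤ n.
record Window (p : Loc) : Set where
  constructor window
  field
    lower : 2 ≤ index p
    upper : index p ≤ 18

data Ball : ℕ → Loc → Set where
  centre : ∀ {p} → Window p → Ball zero p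
  ball   : ∀ {k p} → Window p → All (Ball k) (nbrs p) → Ball (suc k) p

Window⇒Small : ∀ {p} → Window p → Small p
Window⇒Small (window _ p≤18) = s≤s (≤-trans p≤18 (m≤m+n 18 2))

nbrs-small : ∀ {p q} → Window p → q ∈ nbrs p → Small q
nbrs-small (window _ p≤18) q∈ = s≤s (≤-trans (nbrs-index q∈) (+-monoʳ-≤ 2 p≤18))

Ball⇒Window : ∀ {k p} → Ball k p → Window p
Ball⇒Window (centre w) = w
Ball⇒Window (ball w _) = w

Ball-nbrs : ∀ {k p q} → Ball (suc k) p → q ∈ nbrs p → Ball k q
Ball-nbrs (ball _ balls) = All.lookup balls

-- The last edge is tested as x₇ ∈ nbrs a, so that x₇ itself need not lie in the window.
Closing : Loc → Loc → Loc → Loc → Set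
Closing a x y b =
  Any (λ x₄ → Any (λ x₅ → Any (λ x₆ → Any (λ x₇ →
    x₇ ∈ nbrs a × Unique (a ∷ x ∷ y ∷ b ∷ x₄ ∷ x₅ ∷ x₆ ∷ x₇ ∷ []))
  (nbrs x₆)) (nbrs x₅)) (nbrs x₄)) (nbrs b)

ArcsClose : Loc → Set
ArcsClose x = All (λ y → All (λ a → a ≢ y → All (λ b → b ≢ x → Closing a x y b) (nbrs y)) (nbrs x)) (nbrs x)

_≟ᴸ_ : DecidableEquality Layer
uL ≟ᴸ uL = yes refl
uL ≟ᴸ vL = no λ ()
vL ≟ᴸ uL = no λ ()
vL ≟ᴸ vL = yes refl

_≟_ : DecidableEquality Loc
_≟_ = ≡-dec _≟ᴸ_ (≡-dec ℕ._≟_ Bool._≟_)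

open import Data.List.Membership.DecPropositional _≟_ using (_∈?_)
open import Data.List.Relation.Unary.Unique.DecPropositional _≟_ using (unique?)

window? : Decidable Window
window? p = map′ (uncurry window) (λ (window l u) → l , u) ((2 ℕ.≤? index p) ×-dec (index p ℕ.≤? 18))

ball? : ∀ k → Decidable (Ball k)
ball? zero    p = map′ centre Ball⇒Window (window? p)
ball? (suc k) p = map′ (uncurry ball) (λ { (ball w balls) → w , balls }) (window? p ×-dec all? (ball? k) (nbrs p))

closing? : ∀ a x y b → Dec (Closing a x y b)
closing? a x y b =
  any? (λ x₄ → any? (λ x₅ → any? (λ x₆ → any? (λ x₇ →
    (x₇ ∈? nbrs a) ×-dec unique? (a ∷ x ∷ y ∷ b ∷ x₄ ∷ x₅ ∷ x₆ ∷ x₇ ∷ []))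
  (nbrs x₆)) (nbrs x₅)) (nbrs x₄)) (nbrs b)

arcsClose? : Decidable ArcsClose
arcsClose? x =
  all? (λ y → all? (λ a → ¬? (a ≟ y) →-dec all? (λ b → ¬? (b ≟ x) →-dec closing? a x y b) (nbrs y)) (nbrs x)) (nbrs x)

module DGP₂ (m : ℕ) (20<N : 20 < suc m) where
  open Cyclic m
  open EightCycles (Adj N 2)

  V : Set
  V = Vertex N

  Adj-sym : ∀ {x y} → Adj N 2 x y → Adj N 2 y x
  Adj-sym = swap

  -- Matching on Adj cannot invert next, so the backward edges are recorded by equations.
  data NeighbourView : V → V → Set where
    outer⁺ : ∀ i p → NeighbourView (uL , i , p) (uL , next i , not p)
    outer⁻ : ∀ {i} i' p → i ≡ next i' → NeighbourView (uL , i , p) (uL , i' , not p)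
    inner⁺ : ∀ i p → NeighbourView (vL , i , p) (vL , next (next i) , not p)
    inner⁻ : ∀ {i} i' p → i ≡ next (next i') → NeighbourView (vL , i , p) (vL , i' , not p)
    spoke⁺ : ∀ i p → NeighbourView (uL , i , p) (vL , i , not p)
    spoke⁻ : ∀ i p → NeighbourView (vL , i , p) (uL , i , not p)

  view : ∀ {x y} → Adj N 2 x y → NeighbourView x y
  view (inj₁ (inj₁ (outer i p))) = outer⁺ i p
  view (inj₁ (inj₁ (inner i p))) = inner⁺ i p
  view (inj₁ (inj₂ (spoke i p))) = spoke⁺ i p
  view (inj₂ (inj₁ (outer i p))) =
    subst (λ q → NeighbourView (uL , next i , not p) (uL , i , q)) (Bool.not-involutive p) (outer⁻ i (not p) refl)
  view (inj₂ (inj₁ (inner i p))) =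
    subst (λ q → NeighbourView (vL , next (next i) , not p) (vL , i , q)) (Bool.not-involutive p) (inner⁻ i (not p) refl)
  view (inj₂ (inj₂ (spoke i p))) =
    subst (λ q → NeighbourView (vL , i , not p) (uL , i , q)) (Bool.not-involutive p) (spoke⁻ i (not p))

  module Chart (b : Fin N) (j : Bool) where

    emb : Loc → V
    emb (l , c , p) = l , shift c b , p xor j

    emb-flip : ∀ l {i} c p → i ≡ shift c b → (l , i , not (p xor j)) ≡ emb (l , c , not p)
    emb-flip l c p refl = cong (λ q → l , shift c b , q) (Bool.not-distribˡ-xor p j)

    outer-step : ∀ c p → Adj N 2 (emb (uL , c , p)) (emb (uL , suc c , not p))
    outer-step c p = subst (Adj N 2 _) (emb-flip uL (suc c) p refl) (inj₁ (inj₁ (outer (shift c b) (p xor j))))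

    inner-step : ∀ c p → Adj N 2 (emb (vL , c , p)) (emb (vL , 2 + c , not p))
    inner-step c p = subst (Adj N 2 _) (emb-flip vL (2 + c) p refl) (inj₁ (inj₁ (inner (shift c b) (p xor j))))

    spoke-step : ∀ c p → Adj N 2 (emb (uL , c , p)) (emb (vL , c , not p))
    spoke-step c p = subst (Adj N 2 _) (emb-flip vL c p refl) (inj₁ (inj₂ (spoke (shift c b) (p xor j))))

    backwards : ∀ {l l' c c'} p → Adj N 2 (emb (l , c , not p)) (emb (l' , c' , not (not p))) →
                Adj N 2 (emb (l' , c' , p)) (emb (l , c , not p))
    backwards {l} {l'} {c} {c'} p e =
      subst (λ q → Adj N 2 (l' , shift c' b , q xor j) (emb (l , c , not p))) (Bool.not-involutive p) (Adj-sym e)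

    nbrs-sound : ∀ {p q} → q ∈ nbrs p → Adj N 2 (emb p) (emb q)
    nbrs-sound {uL , suc (suc c) , p} (here refl)                 = outer-step (2 + c) p
    nbrs-sound {uL , suc (suc c) , p} (there (here refl))         = backwards {uL} {uL} {1 + c} {2 + c} p (outer-step (1 + c) (not p))
    nbrs-sound {uL , suc (suc c) , p} (there (there (here refl))) = spoke-step (2 + c) p
    nbrs-sound {vL , suc (suc c) , p} (here refl)                 = inner-step (2 + c) p
    nbrs-sound {vL , suc (suc c) , p} (there (here refl))         = backwards {vL} {vL} {c} {2 + c} p (inner-step c (not p))
    nbrs-sound {vL , suc (suc c) , p} (there (there (here refl))) = backwards {uL} {vL} {2 + c} {2 + c} p (spoke-step (2 + c) (not p))

    nbrs-complete : ∀ {p y} → Window p → Adj N 2 (emb p) y → ∃ λ q → q ∈ nbrs p × y ≡ emb q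
    nbrs-complete {_ , 0 , _} (window () _)
    nbrs-complete {_ , 1 , _} (window (s≤s ()) _)
    nbrs-complete {uL , suc (suc c) , p} _ e with view e
    ... | outer⁺ _ _    = _ , here refl , emb-flip uL (3 + c) p refl
    ... | outer⁻ i _ eq = _ , there (here refl) , emb-flip uL (1 + c) p (sym (shift-injectiveʳ 1 (s≤s z≤n) eq))
    ... | spoke⁺ _ _    = _ , there (there (here refl)) , emb-flip vL (2 + c) p refl
    nbrs-complete {vL , suc (suc c) , p} _ e with view e
    ... | inner⁺ _ _    = _ , here refl , emb-flip vL (4 + c) p refl
    ... | inner⁻ i _ eq = _ , there (here refl) , emb-flip vL c p (sym (shift-injectiveʳ 2 2≤N eq))
      where
      2≤N : 2 ≤ N
      2≤N = ≤-trans (s≤s (s≤s z≤n)) 20<N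
    ... | spoke⁻ _ _    = _ , there (there (here refl)) , emb-flip uL (2 + c) p refl

    emb-injective : ∀ {p q} → Small p → Small q → emb p ≡ emb q → p ≡ q
    emb-injective {_ , c , _} {_ , c' , _} c<21 c'<21 e =
      cong₂ _,_ (cong proj₁ e)
        (cong₂ _,_ (shift-injectiveˡ b (below c<21) (below c'<21) (cong (proj₁ ∘ proj₂) e))
                   (xor-cancelʳ j (cong (proj₂ ∘ proj₂) e)))
      where
      below : ∀ {k} → k < 21 → k < N
      below k<21 = <-≤-trans k<21 20<N

    emb-distinct : ∀ {p q} → Small p → Small q → p ≢ q → emb p ≢ emb q
    emb-distinct sp sq p≢q = p≢q ∘ emb-injective sp sq

    emb-unique : ∀ {xs} → All Small xs → Unique xs → Unique (map emb xs)
    emb-unique []       []         = []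
    emb-unique (s ∷ ss) (x∉ ∷ xs!) =
      All.map⁺ (All.zipWith (λ (s' , x≢) → emb-distinct s s' x≢) (ss , x∉)) ∷ emb-unique ss xs!

    closing⇒On8Cycle : ∀ {a x y b} → Window a → Small x → Small y → Ball 3 b →
                       Closing a x y b → On8Cycle (emb a) (emb x) (emb y) (emb b)
    closing⇒On8Cycle {a} {x} {y} {b} wa sx sy ballb closing
      with find closing
    ... | x₄ , x₄∈ , c₄ with find c₄
    ... | x₅ , x₅∈ , c₅ with find c₅
    ... | x₆ , x₆∈ , c₆ with find c₆
    ... | x₇ , x₇∈ , x₇∈a , distinct =
      emb x₄ , emb x₅ , emb x₆ , emb x₇ ,
      nbrs-sound x₄∈ , nbrs-sound x₅∈ , nbrs-sound x₆∈ , nbrs-sound x₇∈ , Adj-sym (nbrs-sound x₇∈a) ,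
      emb-unique (Window⇒Small wa ∷ sx ∷ sy ∷ Window⇒Small wb ∷
                  nbrs-small wb x₄∈ ∷ nbrs-small w₄ x₅∈ ∷ nbrs-small w₅ x₆∈ ∷ nbrs-small w₆ x₇∈ ∷ []) distinct
      where
      ball₄ : Ball 2 x₄
      ball₄ = Ball-nbrs ballb x₄∈
      ball₅ : Ball 1 x₅
      ball₅ = Ball-nbrs ball₄ x₅∈
      wb : Window b
      wb = Ball⇒Window ballb
      w₄ : Window x₄
      w₄ = Ball⇒Window ball₄
      w₅ : Window x₅
      w₅ = Ball⇒Window ball₅
      w₆ : Window x₆
      w₆ = Ball⇒Window (Ball-nbrs ball₅ x₆∈)

    Ball-complete : ∀ {k p y} → Ball (suc k) p → Adj N 2 (emb p) y → ∃ λ q → q ∈ nbrs p × Ball k q × y ≡ emb q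
    Ball-complete b₀ e with nbrs-complete (Ball⇒Window b₀) e
    ... | q , q∈ , refl = q , q∈ , Ball-nbrs b₀ q∈ , refl

    On8Cycle⇒closing : ∀ {a x y b} → Window a → Small x → Small y → Ball 3 b →
                       On8Cycle (emb a) (emb x) (emb y) (emb b) → Closing a x y b
    On8Cycle⇒closing {a} {x} {y} {b} wa sx sy ballb (_ , _ , _ , _ , e₄ , e₅ , e₆ , e₇ , e₈ , distinct)
      with Ball-complete ballb e₄
    ... | x₄ , x₄∈ , ball₄ , refl with Ball-complete ball₄ e₅
    ... | x₅ , x₅∈ , ball₅ , refl with Ball-complete ball₅ e₆
    ... | x₆ , x₆∈ , ball₆ , refl with nbrs-complete (Ball⇒Window ball₆) e₇ | nbrs-complete wa (Adj-sym e₈)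
    ... | x₇ , x₇∈ , refl | x₇' , x₇'∈ , e =
      lose x₄∈ (lose x₅∈ (lose x₆∈ (lose x₇∈ (x₇∈a , Unique.map⁻ {f = emb} {xs = a ∷ x ∷ y ∷ b ∷ x₄ ∷ x₅ ∷ x₆ ∷ x₇ ∷ []} distinct))))
      where
      x₇∈a : x₇ ∈ nbrs a
      x₇∈a = subst (_∈ nbrs a) (sym (emb-injective (nbrs-small (Ball⇒Window ball₆) x₇∈) (nbrs-small wa x₇'∈) e)) x₇'∈

    ArcsClose⇒ArcsOn8Cycles : ∀ {x} → Ball 5 x → ArcsClose x → ArcsOn8Cycles (emb x)
    ArcsClose⇒ArcsOn8Cycles {x} ballx close xy xa a≢y yb b≢x
      with Ball-complete ballx xy | Ball-complete ballx xa
    ... | y , y∈ , bally , refl | a , a∈ , balla , refl with Ball-complete bally yb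
    ... | b , b∈ , ballb , refl =
      closing⇒On8Cycle (Ball⇒Window balla) (Window⇒Small (Ball⇒Window ballx))
        (Window⇒Small (Ball⇒Window bally)) ballb
        (All.lookup (All.lookup (All.lookup close y∈) a∈ (a≢y ∘ cong emb)) b∈ (b≢x ∘ cong emb))

  recentre : ∀ l i p {c} → c ≤ N → (l , i , p) ≡ Chart.emb (shift (N ∸ c) i) p (l , c , false)
  recentre l i p c≤N = cong (λ i' → l , i' , p) (sym (shift-∸ c≤N i))

  outer-arcs : ∀ i p → ArcsOn8Cycles (uL , i , p)
  outer-arcs i p = subst ArcsOn8Cycles (sym (recentre uL i p 10≤N))
    (ArcsClose⇒ArcsOn8Cycles (from-yes (ball? 5 u₁₀)) (from-yes (arcsClose? u₁₀)))
    where
    open Chart (shift (N ∸ 10) i) p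
    10≤N : 10 ≤ N
    10≤N = ≤-trans (m≤m+n 10 11) 20<N
    u₁₀ : Loc
    u₁₀ = uL , 10 , false

  inner-no-arcs : ∀ i p → ¬ ArcsOn8Cycles (vL , i , p)
  inner-no-arcs i p arcs =
    from-no (closing? v₄ v₆ v₈ v₁₀) (On8Cycle⇒closing w₄ s₆ s₈ (from-yes (ball? 3 v₁₀)) cycle)
    where
    open Chart (shift (N ∸ 6) i) p
    v₄ v₆ v₈ v₁₀ : Loc
    v₄  = vL , 4 , true
    v₆  = vL , 6 , false
    v₈  = vL , 8 , true
    v₁₀ = vL , 10 , false
    w₄ : Window v₄
    w₄ = from-yes (window? v₄)
    s₆ : Small v₆
    s₆ = Window⇒Small (from-yes (window? v₆))
    s₈ : Small v₈
    s₈ = Window⇒Small (from-yes (window? v₈))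
    s₁₀ : Small v₁₀
    s₁₀ = Window⇒Small (from-yes (window? v₁₀))
    6≤N : 6 ≤ N
    6≤N = ≤-trans (m≤m+n 6 15) 20<N
    cycle : On8Cycle (emb v₄) (emb v₆) (emb v₈) (emb v₁₀)
    cycle = subst ArcsOn8Cycles (recentre vL i p 6≤N) arcs {emb v₈} {emb v₄} {emb v₁₀}
      (nbrs-sound {v₆} (here refl)) (nbrs-sound {v₆} (there (here refl)))
      (emb-distinct {v₄} {v₈} (Window⇒Small w₄) s₈ λ ())
      (nbrs-sound {v₈} (here refl)) (emb-distinct {v₁₀} {v₆} s₁₀ s₆ λ ())

  arcs⇒outer : ∀ x → ArcsOn8Cycles x → proj₁ x ≡ uL
  arcs⇒outer (uL , _ , _) _    = refl
  arcs⇒outer (vL , i , p) arcs = ⊥-elim (inner-no-arcs i p arcs)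

  outer⇒arcs : ∀ x → proj₁ x ≡ uL → ArcsOn8Cycles x
  outer⇒arcs (uL , i , p) _ = outer-arcs i p

  layer-preserved : ∀ {f} → IsAutomorphism f → ∀ x → proj₁ (Inverse.to f x) ≡ proj₁ x
  layer-preserved {f} aut x =
    same-layer (arcs⇒outer (to x) ∘ ArcsOn8Cycles-image {f} aut ∘ outer⇒arcs x)
               (arcs⇒outer x ∘ ArcsOn8Cycles-preimage {f} aut ∘ outer⇒arcs (to x))
    where
    open Inverse f
    same-layer : ∀ {l l'} → (l ≡ uL → l' ≡ uL) → (l' ≡ uL → l ≡ uL) → l' ≡ l
    same-layer {uL} {uL} _ _ = refl
    same-layer {uL} {vL} l→l' _ with l→l' refl
    ... | ()
    same-layer {vL} {uL} _ l'→l with l'→l refl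
    ... | ()
    same-layer {vL} {vL} _ _ = refl

  spokes-image : ∀ {f} → IsAutomorphism f → ∀ {x y} → Spoke N x y → Spoke N (Inverse.to f x) (Inverse.to f y)
  spokes-image {f} aut {x} {y} s = crossing-edge⇒spoke (proj₁ (aut x y) (spoke⇒adj s)) crosses
    where
    crosses : proj₁ (Inverse.to f x) ≢ proj₁ (Inverse.to f y)
    crosses e = spoke-crosses s (trans (sym (layer-preserved {f} aut x)) (trans e (layer-preserved {f} aut y)))

lemma5p9 : (n : ℕ) → 20 < n → (f : Vertex n ↔ Vertex n) → IsAut n 2 f → StabilizesSpokes n f
lemma5p9 zero    ()
lemma5p9 (suc m) 20<n f aut =
    (λ _ _ → spokes-image {f} aut)
  , (λ x y s → from x , from y , spokes-image {↔-sym f} (IsAutomorphism-sym {f} aut) s , strictlyInverseˡ x , strictlyInverseˡ y)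
  where
  open Inverse f
  open DGP₂ m 20<n
  open EightCycles (Adj (suc m) 2)
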